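{- Let $\mathcal{G}$ be a snake graph with triangular snake graph $\mathcal{T}_\mathcal{G}$, and let $k\ge 1$. Then $\mathcal{T}_\mathcal{G}$ contains exactly $k-1$ hourglass graphs as subgraphs if and only if the number of sources (equivalently, of sinks) of $\mathcal{T}_\mathcal{G}$ is $k$.
   Context: A snake graph $\mathcal{G}$ with $d\ge1$ tiles is formed by a sequence of unit squares (tiles, each a 4-cycle with north, south, east, west edges) $G_1,\dots,G_d$ in $\mathbb{Z}^2$ such that for each $i<d$, $G_{i+1}$ is either immediately above $G_i$ (north edge of $G_i$ = south edge of $G_{i+1}$) or immediately to the right of $G_i$ (east edge of $G_i$ = west edge of $G_{i+1}$). Triangular snake graph: for odd $i$ let $c_i$ be the north edge of $G_i$, for even $i$ the south edge. $\mathcal{T}_\mathcal{G}$ is obtained from $\mathcal{G}$ by contracting each $c_i$ to a vertex $\mathbf{c}_i$ and orienting remaining edges: for odd $i$, with $a,b$ the south-west and south-east corners of $G_i$, arrows $a\to b$ (south edge), $a\to\mathbf{c}_i$ (west edge), $\mathbf{c}_i\to b$ (east edge); for even $i$, with $a,b$ the north-west and north-east corners, arrows $a\to b$ (north edge), $a\to\mathbf{c}_i$ (west), $\mathbf{c}_i\to b$ (east). These three arrows form the triangular tile labeled $i$. An hourglass graph in $\mathcal{T}_\mathcal{G}$ is the subgraph formed by the two triangular tiles labeled $i$ (the body) and $i+1$ (the head), for an odd index $i$ such that $G_{i+1}$ lies immediately above $G_i$; the two triangles share the vertex $\mathbf{c}_i=\mathbf{c}_{i+1}$ (the neck). Sources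 (resp. sinks) are vertices with no incoming (resp. outgoing) arrows. -}

module Defs where

open import Data.Nat using (ℕ; zero; suc; _+_; _≡ᵇ_)
open import Data.Bool using (Bool; true; false; if_then_else_; _∧_; not)
open import Data.Product using (_×_; _,_; proj₁; proj₂)
open import Data.List using (List; []; _∷_; _++_; length; concatMap; map)

-- Snake graphs ------------------------------------------------------------
-- A snake graph with d ≥ 1 tiles G₁,…,G_d is determined (up to translation)
-- by the list of d-1 steps: step j says whether G_{j+1} lies immediately
-- above (U) or immediately to the right (R) of G_j.
data Dir : Set where
  U R : Dir

SnakeGraph : Set
SnakeGraph = List Dir

numTiles : SnakeGraph → ℕ
numTiles ds = suc (length ds)

-- Lattice points of ℤ² (we place G₁ with south-west corner at the origin,
-- so all corners have non-negative coordinates).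
Point : Set
Point = ℕ × ℕ

_==P_ : Point → Point → Bool
(a , b) ==P (c , d) = (a ≡ᵇ c) ∧ (b ≡ᵇ d)

isOdd : ℕ → Bool
isOdd zero = false
isOdd (suc n) = not (isOdd n)

tilesFrom : ℕ → Point → List Dir → List (ℕ × Point)
tilesFrom i p [] = (i , p) ∷ []
tilesFrom i (x , y) (U ∷ ds) = (i , (x , y)) ∷ tilesFrom (suc i) (x , suc y) ds
tilesFrom i (x , y) (R ∷ ds) = (i , (x , y)) ∷ tilesFrom (suc i) (suc x , y) ds

tiles : SnakeGraph → List (ℕ × Point)
tiles ds = tilesFrom 1 (0 , 0) ds

corners : ℕ × Point → List Point
corners (_ , (x , y)) = (x , y) ∷ (suc x , y) ∷ (x , suc y) ∷ (suc x , suc y) ∷ []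

-- The contracted edge c_i as (west endpoint , east endpoint):
-- north edge of G_i for odd i, south edge for even i.
cEdge : ℕ × Point → Point × Point
cEdge (i , (x , y)) =
  if isOdd i then ((x , suc y) , (suc x , suc y)) else ((x , y) , (suc x , y))

cEdges : SnakeGraph → List (Point × Point)
cEdges ds = map cEdge (tiles ds)

-- Each contracted edge c_i is represented by its west endpoint.
-- (All c_i are horizontal, their west endpoints have odd and their east
-- endpoints even coordinate sum, so distinct c_i are vertex-disjoint and
-- this is exactly the quotient by contracting all c_i.)
repIn : List (Point × Point) → Point → Point
repIn [] p = p
repIn ((w , e) ∷ cs) p = if e ==P p then w else repIn cs p

contract : SnakeGraph → Point → Point
contract ds = repIn (cEdges ds)

filterᵇ : {A : Set} → (A → Bool) → List A → List A
filterᵇ f [] = []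
filterᵇ f (x ∷ xs) = if f x then x ∷ filterᵇ f xs else filterᵇ f xs

anyᵇ : {A : Set} → (A → Bool) → List A → Bool
anyᵇ f [] = false
anyᵇ f (x ∷ xs) = if f x then true else anyᵇ f xs

dedup : List Point → List Point
dedup [] = []
dedup (p ∷ ps) = p ∷ filterᵇ (λ q → not (p ==P q)) (dedup ps)

vertices : SnakeGraph → List Point
vertices ds = dedup (map (contract ds) (concatMap corners (tiles ds)))

triArrows : SnakeGraph → ℕ × Point → List (Point × Point)
triArrows ds (i , (x , y)) =
  if isOdd i
  then arrs (x , y) (suc x , y) (x , suc y)
  else arrs (x , suc y) (suc x , suc y) (x , y)
  where
    -- a, b: the two uncontracted corners; c': an endpoint of c_i
    arrs : Point → Point → Point → List (Point × Point)
    arrs a b c' = (κ a , κ b) ∷ (κ a , κ c') ∷ (κ c' , κ b) ∷ []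
      where κ = contract ds

arrows : SnakeGraph → List (Point × Point)
arrows ds = concatMap (triArrows ds) (tiles ds)

isSource : SnakeGraph → Point → Bool
isSource ds v = not (anyᵇ (λ a → proj₂ a ==P v) (arrows ds))

isSink : SnakeGraph → Point → Bool
isSink ds v = not (anyᵇ (λ a → proj₁ a ==P v) (arrows ds))

numSources : SnakeGraph → ℕ
numSources ds = length (filterᵇ (isSource ds) (vertices ds))

numSinks : SnakeGraph → ℕ
numSinks ds = length (filterᵇ (isSink ds) (vertices ds))

-- Hourglass graphs: odd i < d with G_{i+1} immediately above G_i,
-- i.e. step i (1-indexed) is U with i odd.
hourglassFrom : ℕ → List Dir → ℕ
hourglassFrom i [] = 0
hourglassFrom i (U ∷ ds) = (if isOdd i then 1 else 0) + hourglassFrom (suc i) ds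
hourglassFrom i (R ∷ ds) = hourglassFrom (suc i) ds

numHourglasses : SnakeGraph → ℕ
numHourglasses ds = hourglassFrom 1 ds

-- Every arrow of T_G ends in an uncontracted b-corner or in a contracted vertex c_i, both of
-- odd coordinate sum, while every a-corner has even coordinate sum. Hence the sources are the
-- a-corners that are not the east end of some contracted edge c_k; walking along the snake,
-- these are the a-corner of the first tile and the a-corner of every hourglass head. Dually the
-- sinks are the b-corners that do not coincide with some c_k: the b-corner of the last tile and
-- that of every hourglass body. Both lists are duplicate-free, so there are exactly one more
-- sources, and one more sinks, than hourglasses. All the required distinctness of lattice
-- points follows from the snake being monotone in both coordinates.
module Submission where

open import Defs
open import Data.Bool using (Bool; true; false; not; if_then_else_)
open import Data.Bool.Properties using (T-∧; not-¬)
open import Data.Empty using (⊥-elim)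
open import Data.List using (List; []; _∷_; length; map; filter; deduplicate)
open import Data.List.Properties using (length-map)
open import Data.List.Membership.Propositional using (_∈_; _∉_; lose; find)
open import Data.List.Membership.Propositional.Properties
  using (∈-map⁺; ∈-map⁻; ∈-filter⁺; ∈-filter⁻; ∈-concatMap⁺; ∈-concatMap⁻; deduplicate-∈⇔)
open import Data.List.Membership.Propositional.Properties.WithK using (unique∧set⇒bag)
open import Data.List.Relation.Binary.BagAndSetEquality using (∼bag⇒↭)
open import Data.List.Relation.Binary.Permutation.Propositional.Properties using (↭-length)
open import Data.List.Relation.Unary.All as All using ()
open import Data.List.Relation.Unary.All.Properties as All using ()
open import Data.List.Relation.Unary.AllPairs using ([]; _∷_)
open import Data.List.Relation.Unary.Any using (here; there)
open import Data.List.Relation.Unary.Unique.Propositional using (Unique)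
open import Data.List.Relation.Unary.Unique.Propositional.Properties as Unique using ()
open import Data.Nat using (ℕ; zero; suc; _+_; _∸_; _≤_; z≤n; s≤s)
open import Data.Nat.Properties
  using (≡ᵇ⇒≡; ≡⇒≡ᵇ; +-suc; +-identityʳ; suc-injective; ≤-refl; ≤-reflexive; ≤-trans; n≤1+n;
         m≤m+n; 1+n≰n; <⇒≤; ≤-<-connex; m≤n⇒m<n∨m≡n)
open import Data.Product using (_×_; _,_; proj₁; proj₂; ∃-syntax)
open import Data.Sum using (_⊎_; inj₁; inj₂; [_,_])
open import Function.Base using (_∘_)
open import Function.Bundles using (_⇔_; mk⇔; Equivalence)
open import Level using (0ℓ)
open import Relation.Binary.Definitions using (DecidableEquality)
open import Relation.Binary.PropositionalEquality
  using (_≡_; _≢_; refl; sym; trans; cong; cong₂; subst; module ≡-Reasoning)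
open import Relation.Nullary.Decidable using (does; _because_; ¬?)
open import Relation.Nullary.Negation using (¬_)
open import Relation.Nullary.Reflects using (Reflects; ofʸ; ofⁿ; fromEquivalence; ¬-reflects)
open import Relation.Unary using (Pred; Decidable)

false-or-true : ∀ b → b ≡ false ⊎ b ≡ true
false-or-true false = inj₁ refl
false-or-true true  = inj₂ refl

==P-reflects : ∀ p q → Reflects (p ≡ q) (p ==P q)
==P-reflects (x , y) (x′ , y′) = fromEquivalence
  (λ t → let tx , ty = Equivalence.to T-∧ t in cong₂ _,_ (≡ᵇ⇒≡ x x′ tx) (≡ᵇ⇒≡ y y′ ty))
  (λ { refl → Equivalence.from T-∧ (≡⇒≡ᵇ x x refl , ≡⇒≡ᵇ y y refl) })

_≟P_ : DecidableEquality Point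
p ≟P q = (p ==P q) because ==P-reflects p q

open import Data.List.Relation.Unary.Unique.DecPropositional.Properties _≟P_ using (deduplicate-!)

module _ {A : Set} where

  filterᵇ≡filter : ∀ {P : Pred A 0ℓ} (P? : Decidable P) {f : A → Bool} →
                   (∀ x → does (P? x) ≡ f x) → ∀ xs → filterᵇ f xs ≡ filter P? xs
  filterᵇ≡filter P? agree [] = refl
  filterᵇ≡filter P? {f} agree (x ∷ xs) rewrite agree x with f x
  ... | true  = cong (x ∷_) (filterᵇ≡filter P? agree xs)
  ... | false = filterᵇ≡filter P? agree xs

  anyᵇ-==P-reflects : ∀ (f : A → Point) q xs → Reflects (q ∈ map f xs) (anyᵇ (λ x → f x ==P q) xs)
  anyᵇ-==P-reflects f q [] = ofⁿ λ ()
  anyᵇ-==P-reflects f q (x ∷ xs) with f x ==P q | ==P-reflects (f x) q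
  ... | true  | ofʸ fx≡q = ofʸ (here (sym fx≡q))
  ... | false | ofⁿ fx≢q with anyᵇ (λ x → f x ==P q) xs | anyᵇ-==P-reflects f q xs
  ...   | true  | ofʸ q∈ = ofʸ (there q∈)
  ...   | false | ofⁿ q∉ = ofⁿ λ { (here q≡fx) → fx≢q (sym q≡fx) ; (there q∈) → q∉ q∈ }

  unique-map⁺ : ∀ {B : Set} (f : A → B) {xs} → (∀ {x y} → x ∈ xs → y ∈ xs → f x ≡ f y → x ≡ y) →
                Unique xs → Unique (map f xs)
  unique-map⁺ f inj [] = []
  unique-map⁺ f inj (x∉ ∷ xs!) =
    All.map⁺ (All.tabulate λ y∈ fx≡fy → All.lookup x∉ y∈ (inj (here refl) (there y∈) fx≡fy)) ∷
    unique-map⁺ f (λ x∈ y∈ → inj (there x∈) (there y∈)) xs!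

  length-filter-unique : ∀ {P : Pred A 0ℓ} (P? : Decidable P) {xs ys} → Unique xs → Unique ys →
                         (∀ {z} → (z ∈ xs × P z) ⇔ z ∈ ys) → length (filter P? xs) ≡ length ys
  length-filter-unique P? {xs} {ys} xs! ys! spec =
    ↭-length (∼bag⇒↭ (unique∧set⇒bag (Unique.filter⁺ P? xs!) ys! (mk⇔ to from)))
    where
    to : ∀ {z} → z ∈ filter P? xs → z ∈ ys
    to z∈ = Equivalence.to spec (∈-filter⁻ P? z∈)
    from : ∀ {z} → z ∈ ys → z ∈ filter P? xs
    from z∈ = let z∈xs , Pz = Equivalence.from spec z∈ in ∈-filter⁺ P? z∈xs Pz

dedup≡deduplicate : ∀ ps → dedup ps ≡ deduplicate _≟P_ ps
dedup≡deduplicate []       = refl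
dedup≡deduplicate (p ∷ ps) = cong (p ∷_) (begin
  filterᵇ (λ q → not (p ==P q)) (dedup ps) ≡⟨ filterᵇ≡filter (¬? ∘ (p ≟P_)) (λ _ → refl) (dedup ps) ⟩
  filter (¬? ∘ (p ≟P_)) (dedup ps)         ≡⟨ cong (filter (¬? ∘ (p ≟P_))) (dedup≡deduplicate ps) ⟩
  filter (¬? ∘ (p ≟P_)) (deduplicate _≟P_ ps) ∎)
  where open ≡-Reasoning

repIn-spec : ∀ cs p →
  (∃[ w ] (w , p) ∈ cs × repIn cs p ≡ w) ⊎ ((∀ {w} → (w , p) ∉ cs) × repIn cs p ≡ p)
repIn-spec []             p = inj₂ ((λ ()) , refl)
repIn-spec ((w , z) ∷ cs) p with z ==P p | ==P-reflects z p
... | true  | ofʸ refl = inj₁ (w , here refl , refl)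
... | false | ofⁿ z≢p with repIn-spec cs p
...   | inj₁ (w′ , w′p∈ , r) = inj₁ (w′ , there w′p∈ , r)
...   | inj₂ (fresh , r)      = inj₂ ((λ { (here refl) → z≢p refl ; (there wp∈) → fresh wp∈ }) , r)

-- Monotone lattice walks

σ : Point → ℕ
σ (x , y) = x + y

parity : Point → Bool
parity p = isOdd (σ p)

move : Dir → Point → Point
move U (x , y) = (x , suc y)
move R (x , y) = (suc x , y)

walk : Point → List Dir → ℕ → Point
walk p ds       zero    = p
walk p []       (suc n) = p
walk p (d ∷ ds) (suc n) = walk (move d p) ds n

-- The value R past the end of the list is junk; stepAt is only queried below the length.
stepAt : List Dir → ℕ → Dir
stepAt []       _       = R
stepAt (d ∷ ds) zero    = d
stepAt (d ∷ ds) (suc n) = stepAt ds n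

σ-move : ∀ d p → σ (move d p) ≡ suc (σ p)
σ-move U (x , y) = +-suc x y
σ-move R (x , y) = refl

σ-walk : ∀ p ds n → n ≤ length ds → σ (walk p ds n) ≡ n + σ p
σ-walk p ds       zero    _        = refl
σ-walk p (d ∷ ds) (suc n) (s≤s n≤) =
  trans (σ-walk (move d p) ds n n≤) (trans (cong (n +_) (σ-move d p)) (+-suc n (σ p)))

walk-suc : ∀ p ds n → suc n ≤ length ds → walk p ds (suc n) ≡ move (stepAt ds n) (walk p ds n)
walk-suc p (d ∷ ds) zero    _        = refl
walk-suc p (d ∷ ds) (suc n) (s≤s n<) = walk-suc (move d p) ds n n<

_≼_ : Point → Point → Set
(x , y) ≼ (x′ , y′) = x ≤ x′ × y ≤ y′

≼-refl : ∀ {p} → p ≼ p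
≼-refl = ≤-refl , ≤-refl

≼-trans : ∀ {p q r} → p ≼ q → q ≼ r → p ≼ r
≼-trans (x≤ , y≤) (x≤′ , y≤′) = ≤-trans x≤ x≤′ , ≤-trans y≤ y≤′

≼-move : ∀ d p → p ≼ move d p
≼-move U p = ≤-refl , n≤1+n _
≼-move R p = n≤1+n _ , ≤-refl

≼-walk : ∀ p ds j → p ≼ walk p ds j
≼-walk p ds       zero    = ≼-refl
≼-walk p []       (suc j) = ≼-refl
≼-walk p (d ∷ ds) (suc j) = ≼-trans (≼-move d p) (≼-walk (move d p) ds j)

walk-mono : ∀ p ds {k j} → k ≤ j → walk p ds k ≼ walk p ds j
walk-mono p ds       {zero}  {j}     _         = ≼-walk p ds j
walk-mono p []       {suc k} {suc j} _         = ≼-refl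
walk-mono p (d ∷ ds) {suc k} {suc j} (s≤s k≤j) = walk-mono (move d p) ds k≤j

tilesFrom-∷ : ∀ i p d ds → tilesFrom i p (d ∷ ds) ≡ (i , p) ∷ tilesFrom (suc i) (move d p) ds
tilesFrom-∷ i p U ds = refl
tilesFrom-∷ i p R ds = refl

∈-tilesFrom⁻ : ∀ i p ds {t} → t ∈ tilesFrom i p ds → ∃[ n ] n ≤ length ds × t ≡ (i + n , walk p ds n)
∈-tilesFrom⁻ i p [] (here refl) = 0 , z≤n , cong (_, p) (sym (+-identityʳ i))
∈-tilesFrom⁻ i p (d ∷ ds) t∈ with subst (_ ∈_) (tilesFrom-∷ i p d ds) t∈
... | here refl = 0 , z≤n , cong (_, p) (sym (+-identityʳ i))
... | there t∈′ with ∈-tilesFrom⁻ (suc i) (move d p) ds t∈′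
...   | n , n≤ , refl = suc n , s≤s n≤ , cong (_, walk (move d p) ds n) (sym (+-suc i n))

∈-tilesFrom⁺ : ∀ i p ds n → n ≤ length ds → (i + n , walk p ds n) ∈ tilesFrom i p ds
∈-tilesFrom⁺ i p []       zero    _        = here (cong (_, p) (+-identityʳ i))
∈-tilesFrom⁺ i p (d ∷ ds) zero    _        =
  subst ((i + 0 , p) ∈_) (sym (tilesFrom-∷ i p d ds)) (here (cong (_, p) (+-identityʳ i)))
∈-tilesFrom⁺ i p (d ∷ ds) (suc n) (s≤s n≤) =
  subst ((i + suc n , q) ∈_) (sym (tilesFrom-∷ i p d ds))
    (there (subst (λ j → (j , q) ∈ tilesFrom (suc i) (move d p) ds) (sym (+-suc i n))
      (∈-tilesFrom⁺ (suc i) (move d p) ds n n≤)))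
  where q = walk (move d p) ds n

-- Corners of a tile

-- The corners of a tile with south-west corner p, where o is the parity of its index counted
-- from 0 (so o = true for the even labels i). Its triangle has the arrows cornerA → cornerB,
-- cornerA → cornerC and cornerC → cornerB, and c_i runs from cornerC (west) to cornerE (east).
cornerA cornerB cornerC cornerE : Bool → Point → Point
cornerA false (x , y) = (x , y)
cornerA true  (x , y) = (x , suc y)
cornerB false (x , y) = (suc x , y)
cornerB true  (x , y) = (suc x , suc y)
cornerC false (x , y) = (x , suc y)
cornerC true  (x , y) = (x , y)
cornerE false (x , y) = (suc x , suc y)
cornerE true  (x , y) = (suc x , y)

∈-corners⁻ : ∀ o p i {q} → q ∈ corners (i , p) →
  q ≡ cornerA o p ⊎ q ≡ cornerB o p ⊎ q ≡ cornerC o p ⊎ q ≡ cornerE o p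
∈-corners⁻ false p i (here refl)                         = inj₁ refl
∈-corners⁻ false p i (there (here refl))                 = inj₂ (inj₁ refl)
∈-corners⁻ false p i (there (there (here refl)))         = inj₂ (inj₂ (inj₁ refl))
∈-corners⁻ false p i (there (there (there (here refl)))) = inj₂ (inj₂ (inj₂ refl))
∈-corners⁻ true  p i (here refl)                         = inj₂ (inj₂ (inj₁ refl))
∈-corners⁻ true  p i (there (here refl))                 = inj₂ (inj₂ (inj₂ refl))
∈-corners⁻ true  p i (there (there (here refl)))         = inj₁ refl
∈-corners⁻ true  p i (there (there (there (here refl)))) = inj₂ (inj₁ refl)

cornerA∈corners : ∀ o p i → cornerA o p ∈ corners (i , p)
cornerA∈corners false p i = here refl
cornerA∈corners true  p i = there (there (here refl))

cornerB∈corners : ∀ o p i → cornerB o p ∈ corners (i , p)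
cornerB∈corners false p i = there (here refl)
cornerB∈corners true  p i = there (there (there (here refl)))

cEdge-tile : ∀ n p → cEdge (suc n , p) ≡ (cornerC (isOdd n) p , cornerE (isOdd n) p)
cEdge-tile n p with isOdd n
... | false = refl
... | true  = refl

triArrows-tile : ∀ ds n p → let κ = contract ds; o = isOdd n in
  triArrows ds (suc n , p) ≡
    (κ (cornerA o p) , κ (cornerB o p)) ∷ (κ (cornerA o p) , κ (cornerC o p)) ∷
    (κ (cornerC o p) , κ (cornerB o p)) ∷ []
triArrows-tile ds n p with isOdd n
... | false = refl
... | true  = refl

parity-cornerA : ∀ p → parity (cornerA (parity p) p) ≡ false
parity-cornerA (x , y) with isOdd (x + y) in odd
... | false = odd
... | true  rewrite +-suc x y | odd = refl

parity-cornerB : ∀ p → parity (cornerB (parity p) p) ≡ true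
parity-cornerB (x , y) with isOdd (x + y) in odd
... | false rewrite odd = refl
... | true  rewrite +-suc x y | odd = refl

parity-cornerC : ∀ p → parity (cornerC (parity p) p) ≡ true
parity-cornerC (x , y) with isOdd (x + y) in odd
... | false rewrite +-suc x y | odd = refl
... | true  = odd

parity-cornerE : ∀ p → parity (cornerE (parity p) p) ≡ false
parity-cornerE (x , y) with isOdd (x + y) in odd
... | false rewrite +-suc x y | odd = refl
... | true  rewrite odd = refl

cornerA-after-R : ∀ o p → cornerA (not o) (move R p) ≡ cornerE o p
cornerA-after-R false p = refl
cornerA-after-R true  p = refl

cornerB-before-R : ∀ o p → cornerB o p ≡ cornerC (not o) (move R p)
cornerB-before-R false p = refl
cornerB-before-R true  p = refl

cornerE≢origin : ∀ o p → cornerE o p ≢ (0 , 0)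
cornerE≢origin false p ()
cornerE≢origin true  p ()

x-cornerB : ∀ o p → proj₁ (cornerB o p) ≡ suc (proj₁ p)
x-cornerB false p = refl
x-cornerB true  p = refl

y-cornerB : ∀ o p → proj₂ p ≤ proj₂ (cornerB o p)
y-cornerB false p = ≤-refl
y-cornerB true  p = n≤1+n _

x-cornerC : ∀ o p → proj₁ (cornerC o p) ≡ proj₁ p
x-cornerC false p = refl
x-cornerC true  p = refl

y-cornerC : ∀ o p → proj₂ p ≤ proj₂ (cornerC o p)
y-cornerC false p = n≤1+n _
y-cornerC true  p = ≤-refl

x-cornerE : ∀ o p → proj₁ (cornerE o p) ≡ suc (proj₁ p)
x-cornerE false p = refl
x-cornerE true  p = refl

y-cornerE : ∀ o p → proj₂ (cornerE o p) ≤ suc (proj₂ p)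
y-cornerE false p = ≤-refl
y-cornerE true  p = n≤1+n _

-- Hourglasses

-- The indices of the hourglass bodies among the tiles of ds, where tiles are counted from 0
-- and the first tile of ds has index n (so the bodies are the tiles of even index).
hourglassesFrom : ℕ → List Dir → List ℕ
hourglassesFrom n []       = []
hourglassesFrom n (U ∷ ds) = if isOdd n then hourglassesFrom (suc n) ds else n ∷ hourglassesFrom (suc n) ds
hourglassesFrom n (R ∷ ds) = hourglassesFrom (suc n) ds

length-hourglassesFrom : ∀ n ds → length (hourglassesFrom n ds) ≡ hourglassFrom (suc n) ds
length-hourglassesFrom n []       = refl
length-hourglassesFrom n (U ∷ ds) with isOdd n
... | true  = length-hourglassesFrom (suc n) ds
... | false = cong suc (length-hourglassesFrom (suc n) ds)
length-hourglassesFrom n (R ∷ ds) = length-hourglassesFrom (suc n) ds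

HourglassAt : ℕ → List Dir → ℕ → Set
HourglassAt n ds m = ∃[ j ] m ≡ n + j × suc j ≤ length ds × isOdd m ≡ false × stepAt ds j ≡ U

HourglassAt-∷ : ∀ {n d ds m} → HourglassAt (suc n) ds m → HourglassAt n (d ∷ ds) m
HourglassAt-∷ {n} (j , refl , j< , even , up) = suc j , sym (+-suc n j) , s≤s j< , even , up

∈-hourglassesFrom⁻ : ∀ n ds {m} → m ∈ hourglassesFrom n ds → HourglassAt n ds m
∈-hourglassesFrom⁻ n (U ∷ ds) m∈ with isOdd n in odd
... | true = HourglassAt-∷ (∈-hourglassesFrom⁻ (suc n) ds m∈)
... | false with m∈
...   | here refl = 0 , sym (+-identityʳ n) , s≤s z≤n , odd , refl
...   | there m∈′ = HourglassAt-∷ (∈-hourglassesFrom⁻ (suc n) ds m∈′)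
∈-hourglassesFrom⁻ n (R ∷ ds) m∈ = HourglassAt-∷ (∈-hourglassesFrom⁻ (suc n) ds m∈)

hourglassesFrom-⊆ : ∀ n d ds {m} → m ∈ hourglassesFrom (suc n) ds → m ∈ hourglassesFrom n (d ∷ ds)
hourglassesFrom-⊆ n U ds m∈ with isOdd n
... | true  = m∈
... | false = there m∈
hourglassesFrom-⊆ n R ds m∈ = m∈

∈-hourglassesFrom⁺ : ∀ n ds {m} → HourglassAt n ds m → m ∈ hourglassesFrom n ds
∈-hourglassesFrom⁺ n (U ∷ ds) (zero , m≡ , _ , even , _) with refl ← trans m≡ (+-identityʳ n)
  rewrite even = here refl
∈-hourglassesFrom⁺ n (d ∷ ds) (suc j , m≡ , s≤s j< , even , up) =
  hourglassesFrom-⊆ n d ds (∈-hourglassesFrom⁺ (suc n) ds (j , trans m≡ (+-suc n j) , j< , even , up))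

hourglassesFrom-unique : ∀ n ds → Unique (hourglassesFrom n ds)
hourglassesFrom-unique n []       = []
hourglassesFrom-unique n (U ∷ ds) with isOdd n
... | true  = hourglassesFrom-unique (suc n) ds
... | false = All.tabulate n∉ ∷ hourglassesFrom-unique (suc n) ds
  where
  n∉ : ∀ {m} → m ∈ hourglassesFrom (suc n) ds → n ≢ m
  n∉ m∈ refl with ∈-hourglassesFrom⁻ (suc n) ds m∈
  ... | j , n≡ , _ = 1+n≰n (subst (suc n ≤_) (sym n≡) (m≤m+n (suc n) j))
hourglassesFrom-unique n (R ∷ ds) = hourglassesFrom-unique (suc n) ds

-- The triangular snake graph of a snake graph

-- Tile n, counted from 0, is G_{n+1}; its south-west corner is P n.
module Snake (ds : SnakeGraph) where

  len : ℕ
  len = length ds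

  P : ℕ → Point
  P = walk (0 , 0) ds

  a b c e : ℕ → Point
  a n = cornerA (isOdd n) (P n)
  b n = cornerB (isOdd n) (P n)
  c n = cornerC (isOdd n) (P n)
  e n = cornerE (isOdd n) (P n)

  κ : Point → Point
  κ = contract ds

  heads tails : List Point
  heads = map proj₂ (arrows ds)
  tails = map proj₁ (arrows ds)

  σ-P : ∀ {n} → n ≤ len → σ (P n) ≡ n
  σ-P {n} n≤ = trans (σ-walk (0 , 0) ds n n≤) (+-identityʳ n)

  P-injective : ∀ {k j} → k ≤ len → j ≤ len → P k ≡ P j → k ≡ j
  P-injective k≤ j≤ Pk≡Pj = trans (sym (σ-P k≤)) (trans (cong σ Pk≡Pj) (σ-P j≤))

  P-step : ∀ {m d} → suc m ≤ len → stepAt ds m ≡ d → P (suc m) ≡ move d (P m)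
  P-step {m} m< refl = walk-suc (0 , 0) ds m m<

  P-mono : ∀ {k j} → k ≤ j → P k ≼ P j
  P-mono = walk-mono (0 , 0) ds

  module _ {n} (n≤ : n ≤ len) where

    a-even : parity (a n) ≡ false
    a-even = subst (λ k → parity (cornerA (isOdd k) (P n)) ≡ false) (σ-P n≤) (parity-cornerA (P n))

    b-odd : parity (b n) ≡ true
    b-odd = subst (λ k → parity (cornerB (isOdd k) (P n)) ≡ true) (σ-P n≤) (parity-cornerB (P n))

    c-odd : parity (c n) ≡ true
    c-odd = subst (λ k → parity (cornerC (isOdd k) (P n)) ≡ true) (σ-P n≤) (parity-cornerC (P n))

    e-even : parity (e n) ≡ false
    e-even = subst (λ k → parity (cornerE (isOdd k) (P n)) ≡ false) (σ-P n≤) (parity-cornerE (P n))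

  a-after-R : ∀ {m} → suc m ≤ len → stepAt ds m ≡ R → a (suc m) ≡ e m
  a-after-R {m} m< right =
    trans (cong (cornerA (not (isOdd m))) (P-step m< right)) (cornerA-after-R (isOdd m) (P m))

  a-after-U-odd : ∀ {m} → suc m ≤ len → stepAt ds m ≡ U → isOdd m ≡ true → a (suc m) ≡ a m
  a-after-U-odd {m} m< up odd =
    trans (cong₂ cornerA (cong not odd) (P-step m< up)) (cong (λ o → cornerA o (P m)) (sym odd))

  b-before-R : ∀ {m} → suc m ≤ len → stepAt ds m ≡ R → b m ≡ c (suc m)
  b-before-R {m} m< right =
    trans (cornerB-before-R (isOdd m) (P m)) (cong (cornerC (not (isOdd m))) (sym (P-step m< right)))

  b-before-U-odd : ∀ {m} → suc m ≤ len → stepAt ds m ≡ U → isOdd m ≡ true → b m ≡ b (suc m)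
  b-before-U-odd {m} m< up odd =
    trans (cong (λ o → cornerB o (P m)) odd) (sym (cong₂ cornerB (cong not odd) (P-step m< up)))

  ∈-tiles⁻ : ∀ {t} → t ∈ tiles ds → ∃[ n ] n ≤ len × t ≡ (suc n , P n)
  ∈-tiles⁻ = ∈-tilesFrom⁻ 1 (0 , 0) ds

  ∈-tiles⁺ : ∀ {n} → n ≤ len → (suc n , P n) ∈ tiles ds
  ∈-tiles⁺ {n} = ∈-tilesFrom⁺ 1 (0 , 0) ds n

  ∈-cEdges⁻ : ∀ {w z} → (w , z) ∈ cEdges ds → ∃[ n ] n ≤ len × w ≡ c n × z ≡ e n
  ∈-cEdges⁻ wz∈ with ∈-map⁻ cEdge wz∈
  ... | t , t∈ , wz≡ with ∈-tiles⁻ t∈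
  ...   | n , n≤ , refl with trans wz≡ (cEdge-tile n (P n))
  ...     | refl = n , n≤ , refl , refl

  ∈-cEdges⁺ : ∀ {n} → n ≤ len → (c n , e n) ∈ cEdges ds
  ∈-cEdges⁺ {n} n≤ = subst (_∈ cEdges ds) (cEdge-tile n (P n)) (∈-map⁺ cEdge (∈-tiles⁺ n≤))

  EastEnd WestEnd : Point → Set
  EastEnd q = ∃[ k ] k ≤ len × q ≡ e k
  WestEnd q = ∃[ k ] k ≤ len × q ≡ c k

  κ-cases : ∀ p → κ p ≡ p ⊎ WestEnd (κ p)
  κ-cases p with repIn-spec (cEdges ds) p
  ... | inj₂ (_ , κp≡p)       = inj₁ κp≡p
  ... | inj₁ (w , wp∈ , κp≡w) with ∈-cEdges⁻ wp∈
  ...   | k , k≤ , w≡ , _ = inj₂ (k , k≤ , trans κp≡w w≡)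

  κ-east : ∀ {p} → EastEnd p → WestEnd (κ p)
  κ-east (k , k≤ , refl) with repIn-spec (cEdges ds) (e k)
  ... | inj₂ (fresh , _)      = ⊥-elim (fresh (∈-cEdges⁺ k≤))
  ... | inj₁ (w , we∈ , κe≡w) with ∈-cEdges⁻ we∈
  ...   | j , j≤ , w≡ , _ = j , j≤ , trans κe≡w w≡

  κ-fixed : ∀ {p} → ¬ EastEnd p → κ p ≡ p
  κ-fixed {p} ¬east with repIn-spec (cEdges ds) p
  ... | inj₂ (_ , κp≡p)    = κp≡p
  ... | inj₁ (w , wp∈ , _) with ∈-cEdges⁻ wp∈
  ...   | k , k≤ , _ , p≡ = ⊥-elim (¬east (k , k≤ , p≡))

  κ-odd : ∀ {p} → parity p ≡ true → κ p ≡ p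
  κ-odd odd = κ-fixed λ { (k , k≤ , refl) → not-¬ (e-even k≤) odd }

  ∈-vertices⁻ : ∀ {q} → q ∈ vertices ds →
    ∃[ n ] n ≤ len × ∃[ p ] (p ≡ a n ⊎ p ≡ b n ⊎ p ≡ c n ⊎ p ≡ e n) × q ≡ κ p
  ∈-vertices⁻ q∈
    with ∈-map⁻ κ (Equivalence.from (deduplicate-∈⇔ _≟P_) (subst (_ ∈_) (dedup≡deduplicate _) q∈))
  ... | p , p∈ , q≡ with find (∈-concatMap⁻ corners {xs = tiles ds} p∈)
  ...   | t , t∈ , p∈t with ∈-tiles⁻ t∈
  ...     | n , n≤ , refl = n , n≤ , p , ∈-corners⁻ (isOdd n) (P n) (suc n) p∈t , q≡

  ∈-vertices⁺ : ∀ {n p} → n ≤ len → p ∈ corners (suc n , P n) → κ p ∈ vertices ds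
  ∈-vertices⁺ {p = p} n≤ p∈ = subst (κ p ∈_) (sym (dedup≡deduplicate _))
    (Equivalence.to (deduplicate-∈⇔ _≟P_) (∈-map⁺ κ (∈-concatMap⁺ corners (lose (∈-tiles⁺ n≤) p∈))))

  vertices-unique : Unique (vertices ds)
  vertices-unique = subst Unique (sym (dedup≡deduplicate _)) (deduplicate-! _)

  ∈-arrows⁻ : ∀ {α} → α ∈ arrows ds → ∃[ n ] n ≤ len ×
    (α ≡ (κ (a n) , κ (b n)) ⊎ α ≡ (κ (a n) , κ (c n)) ⊎ α ≡ (κ (c n) , κ (b n)))
  ∈-arrows⁻ {α} α∈ with find (∈-concatMap⁻ (triArrows ds) {xs = tiles ds} α∈)
  ... | t , t∈ , α∈t with ∈-tiles⁻ t∈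
  ...   | n , n≤ , refl with subst (α ∈_) (triArrows-tile ds n (P n)) α∈t
  ...     | here α≡                 = n , n≤ , inj₁ α≡
  ...     | there (here α≡)         = n , n≤ , inj₂ (inj₁ α≡)
  ...     | there (there (here α≡)) = n , n≤ , inj₂ (inj₂ α≡)

  module _ {n} (n≤ : n ≤ len) where
    private
      tileArrow∈ : ∀ {α} → α ∈ (κ (a n) , κ (b n)) ∷ (κ (a n) , κ (c n)) ∷ (κ (c n) , κ (b n)) ∷ [] →
                   α ∈ arrows ds
      tileArrow∈ {α} α∈ = ∈-concatMap⁺ (triArrows ds)
        (lose (∈-tiles⁺ n≤) (subst (α ∈_) (sym (triArrows-tile ds n (P n))) α∈))

    κa∈tails : κ (a n) ∈ tails
    κa∈tails = ∈-map⁺ proj₁ (tileArrow∈ (here refl))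

    κb∈heads : κ (b n) ∈ heads
    κb∈heads = ∈-map⁺ proj₂ (tileArrow∈ (here refl))

    κc∈heads : κ (c n) ∈ heads
    κc∈heads = ∈-map⁺ proj₂ (tileArrow∈ (there (here refl)))

    κc∈tails : κ (c n) ∈ tails
    κc∈tails = ∈-map⁺ proj₁ (tileArrow∈ (there (there (here refl))))

    κb≡b : κ (b n) ≡ b n
    κb≡b = κ-odd (b-odd n≤)

    κc≡c : κ (c n) ≡ c n
    κc≡c = κ-odd (c-odd n≤)

  westEnd∈heads : ∀ {q} → WestEnd q → q ∈ heads
  westEnd∈heads (k , k≤ , refl) = subst (_∈ heads) (κc≡c k≤) (κc∈heads k≤)

  westEnd∈tails : ∀ {q} → WestEnd q → q ∈ tails
  westEnd∈tails (k , k≤ , refl) = subst (_∈ tails) (κc≡c k≤) (κc∈tails k≤)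

  heads-odd : ∀ {q} → q ∈ heads → parity q ≡ true
  heads-odd q∈ with ∈-map⁻ proj₂ q∈
  ... | α , α∈ , refl with ∈-arrows⁻ α∈
  ...   | n , n≤ , inj₁ refl        = subst (λ q → parity q ≡ true) (sym (κb≡b n≤)) (b-odd n≤)
  ...   | n , n≤ , inj₂ (inj₁ refl) = subst (λ q → parity q ≡ true) (sym (κc≡c n≤)) (c-odd n≤)
  ...   | n , n≤ , inj₂ (inj₂ refl) = subst (λ q → parity q ≡ true) (sym (κb≡b n≤)) (b-odd n≤)

  κa-even-or-west : ∀ {n} → n ≤ len → parity (κ (a n)) ≡ false ⊎ WestEnd (κ (a n))
  κa-even-or-west {n} n≤ with κ-cases (a n)
  ... | inj₁ κa≡a = inj₁ (trans (cong parity κa≡a) (a-even n≤))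
  ... | inj₂ west = inj₂ west

  tails-even-or-west : ∀ {q} → q ∈ tails → parity q ≡ false ⊎ WestEnd q
  tails-even-or-west q∈ with ∈-map⁻ proj₁ q∈
  ... | α , α∈ , refl with ∈-arrows⁻ α∈
  ...   | n , n≤ , inj₁ refl        = κa-even-or-west n≤
  ...   | n , n≤ , inj₂ (inj₁ refl) = κa-even-or-west n≤
  ...   | n , n≤ , inj₂ (inj₂ refl) = inj₂ (n , n≤ , κc≡c n≤)

  hourglasses : List ℕ
  hourglasses = hourglassesFrom 0 ds

  Hourglass : ℕ → Set
  Hourglass m = suc m ≤ len × isOdd m ≡ false × stepAt ds m ≡ U

  ∈-hourglasses⁻ : ∀ {m} → m ∈ hourglasses → Hourglass m
  ∈-hourglasses⁻ m∈ with ∈-hourglassesFrom⁻ 0 ds m∈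
  ... | _ , refl , m< , even , up = m< , even , up

  ∈-hourglasses⁺ : ∀ {m} → Hourglass m → m ∈ hourglasses
  ∈-hourglasses⁺ {m} (m< , even , up) = ∈-hourglassesFrom⁺ 0 ds (m , refl , m< , even , up)

  sources sinks : List Point
  sources = a 0 ∷ map (a ∘ suc) hourglasses
  sinks   = b len ∷ map b hourglasses

  -- Each inequality below is read off one coordinate, using that P is monotone.
  module _ {m} (hg : Hourglass m) where
    private
      m< : suc m ≤ len
      m< = proj₁ hg

      up : stepAt ds m ≡ U
      up = proj₂ (proj₂ hg)

    a-head : a (suc m) ≡ (proj₁ (P m) , suc (suc (proj₂ (P m))))
    a-head = cong₂ cornerA (cong not (proj₁ (proj₂ hg))) (P-step m< up)

    b-body : b m ≡ (suc (proj₁ (P m)) , proj₂ (P m))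
    b-body = cong (λ o → cornerB o (P m)) (proj₁ (proj₂ hg))

    e≢a-head : ∀ {k} → e k ≢ a (suc m)
    e≢a-head {k} ek≡ with ≤-<-connex m k | trans ek≡ a-head
    ... | inj₁ m≤k | eq = 1+n≰n (subst (_≤ proj₁ (P k))
            (trans (sym (cong proj₁ eq)) (x-cornerE (isOdd k) (P k))) (proj₁ (P-mono m≤k)))
    ... | inj₂ k<m | eq = 1+n≰n (≤-trans (≤-reflexive (sym (cong proj₂ eq)))
            (≤-trans (y-cornerE (isOdd k) (P k)) (s≤s (proj₂ (P-mono (<⇒≤ k<m))))))

    c≢b-body : ∀ {k} → c k ≢ b m
    c≢b-body {k} ck≡ with ≤-<-connex k m | trans ck≡ b-body
    ... | inj₁ k≤m | eq = 1+n≰n (subst (_≤ proj₁ (P m))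
            (trans (sym (x-cornerC (isOdd k) (P k))) (cong proj₁ eq)) (proj₁ (P-mono k≤m)))
    ... | inj₂ m<k | eq = 1+n≰n (≤-trans (proj₂ (subst (_≼ P k) (P-step m< up) (P-mono m<k)))
            (≤-trans (y-cornerC (isOdd k) (P k)) (≤-reflexive (cong proj₂ eq))))

    b-last≢b-body : b len ≢ b m
    b-last≢b-body bl≡ = 1+n≰n (≤-trans (proj₂ (subst (_≼ P len) (P-step m< up) (P-mono m<)))
      (≤-trans (y-cornerB (isOdd len) (P len)) (≤-reflexive (cong proj₂ (trans bl≡ b-body)))))

  c≢b-last : ∀ {k} → k ≤ len → c k ≢ b len
  c≢b-last {k} k≤ ck≡ = 1+n≰n (subst (_≤ proj₁ (P len))
    (trans (sym (x-cornerC (isOdd k) (P k))) (trans (cong proj₁ ck≡) (x-cornerB (isOdd len) (P len))))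
    (proj₁ (P-mono k≤)))

  a-cases : ∀ n → n ≤ len → a n ∈ sources ⊎ EastEnd (a n)
  a-cases zero    _  = inj₁ (here refl)
  a-cases (suc m) m< with stepAt ds m in step | false-or-true (isOdd m)
  ... | R | _         = inj₂ (m , <⇒≤ m< , a-after-R m< step)
  ... | U | inj₁ even = inj₁ (there (∈-map⁺ (a ∘ suc) (∈-hourglasses⁺ (m< , even , step))))
  ... | U | inj₂ odd  rewrite a-after-U-odd m< step odd = a-cases m (<⇒≤ m<)

  b-cases-even : ∀ n → n ≤ len → isOdd n ≡ false → b n ∈ sinks ⊎ WestEnd (b n)
  b-cases-even n n≤ even with m≤n⇒m<n∨m≡n n≤
  ... | inj₂ refl = inj₁ (here refl)
  ... | inj₁ n< with stepAt ds n in step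
  ...   | U = inj₁ (there (∈-map⁺ b (∈-hourglasses⁺ (n< , even , step))))
  ...   | R = inj₂ (suc n , n< , b-before-R n< step)

  b-cases : ∀ n → n ≤ len → b n ∈ sinks ⊎ WestEnd (b n)
  b-cases n n≤ with false-or-true (isOdd n)
  ... | inj₁ even = b-cases-even n n≤ even
  ... | inj₂ odd with m≤n⇒m<n∨m≡n n≤
  ...   | inj₂ refl = inj₁ (here refl)
  ...   | inj₁ n< with stepAt ds n in step
  ...     | R = inj₂ (suc n , n< , b-before-R n< step)
  ...     | U rewrite b-before-U-odd n< step odd = b-cases-even (suc n) n< (cong not odd)

  ∈-sources⁻ : ∀ {q} → q ∈ sources → ∃[ n ] n ≤ len × q ≡ a n × ¬ EastEnd q
  ∈-sources⁻ (here refl) = 0 , z≤n , refl , λ { (k , _ , eq) → cornerE≢origin (isOdd k) (P k) (sym eq) }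
  ∈-sources⁻ (there q∈) with ∈-map⁻ (a ∘ suc) q∈
  ... | m , m∈ , refl with ∈-hourglasses⁻ m∈
  ...   | hg = suc m , proj₁ hg , refl , λ { (k , _ , eq) → e≢a-head hg {k} (sym eq) }

  ∈-sinks⁻ : ∀ {q} → q ∈ sinks → ∃[ n ] n ≤ len × q ≡ b n × ¬ WestEnd q
  ∈-sinks⁻ (here refl) = len , ≤-refl , refl , λ { (k , k≤ , eq) → c≢b-last k≤ (sym eq) }
  ∈-sinks⁻ (there q∈) with ∈-map⁻ b q∈
  ... | m , m∈ , refl with ∈-hourglasses⁻ m∈
  ...   | hg = m , <⇒≤ (proj₁ hg) , refl , λ { (k , _ , eq) → c≢b-body hg {k} (sym eq) }

  a-head-injective : ∀ {m m′} → Hourglass m → Hourglass m′ → a (suc m) ≡ a (suc m′) → m ≡ m′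
  a-head-injective hg hg′ eq with trans (sym (a-head hg)) (trans eq (a-head hg′))
  ... | eq′ = P-injective (<⇒≤ (proj₁ hg)) (<⇒≤ (proj₁ hg′))
                (cong₂ _,_ (cong proj₁ eq′) (suc-injective (suc-injective (cong proj₂ eq′))))

  b-body-injective : ∀ {m m′} → Hourglass m → Hourglass m′ → b m ≡ b m′ → m ≡ m′
  b-body-injective hg hg′ eq with trans (sym (b-body hg)) (trans eq (b-body hg′))
  ... | eq′ = P-injective (<⇒≤ (proj₁ hg)) (<⇒≤ (proj₁ hg′))
                (cong₂ _,_ (suc-injective (cong proj₁ eq′)) (cong proj₂ eq′))

  sources-unique : Unique sources
  sources-unique = All.map⁺ (All.tabulate origin≢a-head) ∷
    unique-map⁺ (a ∘ suc) (λ m∈ m′∈ → a-head-injective (∈-hourglasses⁻ m∈) (∈-hourglasses⁻ m′∈))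
      (hourglassesFrom-unique 0 ds)
    where
    origin≢a-head : ∀ {m} → m ∈ hourglasses → a 0 ≢ a (suc m)
    origin≢a-head m∈ eq with cong proj₂ (trans eq (a-head (∈-hourglasses⁻ m∈)))
    ... | ()

  sinks-unique : Unique sinks
  sinks-unique = All.map⁺ (All.tabulate (b-last≢b-body ∘ ∈-hourglasses⁻)) ∷
    unique-map⁺ b (λ m∈ m′∈ → b-body-injective (∈-hourglasses⁻ m∈) (∈-hourglasses⁻ m′∈))
      (hourglassesFrom-unique 0 ds)

  vertex∉heads⇒source : ∀ {q} → q ∈ vertices ds → q ∉ heads → q ∈ sources
  vertex∉heads⇒source q∈ q∉ with ∈-vertices⁻ q∈
  ... | n , n≤ , _ , inj₂ (inj₁ refl) , refl         = ⊥-elim (q∉ (κb∈heads n≤))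
  ... | n , n≤ , _ , inj₂ (inj₂ (inj₁ refl)) , refl = ⊥-elim (q∉ (κc∈heads n≤))
  ... | n , n≤ , _ , inj₂ (inj₂ (inj₂ refl)) , refl = ⊥-elim (q∉ (westEnd∈heads (κ-east (n , n≤ , refl))))
  ... | n , n≤ , _ , inj₁ refl , refl with κ-cases (a n) | a-cases n n≤
  ...   | inj₂ west | _         = ⊥-elim (q∉ (westEnd∈heads west))
  ...   | inj₁ _    | inj₂ east = ⊥-elim (q∉ (westEnd∈heads (κ-east east)))
  ...   | inj₁ κa≡a | inj₁ a∈   = subst (_∈ sources) (sym κa≡a) a∈

  source⇒vertex∉heads : ∀ {q} → q ∈ sources → q ∈ vertices ds × q ∉ heads
  source⇒vertex∉heads q∈ with ∈-sources⁻ q∈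
  ... | n , n≤ , refl , ¬east =
    subst (_∈ vertices ds) (κ-fixed ¬east) (∈-vertices⁺ n≤ (cornerA∈corners (isOdd n) (P n) (suc n))) ,
    λ a∈ → not-¬ (a-even n≤) (heads-odd a∈)

  vertex∉tails⇒sink : ∀ {q} → q ∈ vertices ds → q ∉ tails → q ∈ sinks
  vertex∉tails⇒sink q∈ q∉ with ∈-vertices⁻ q∈
  ... | n , n≤ , _ , inj₁ refl , refl                = ⊥-elim (q∉ (κa∈tails n≤))
  ... | n , n≤ , _ , inj₂ (inj₂ (inj₁ refl)) , refl = ⊥-elim (q∉ (κc∈tails n≤))
  ... | n , n≤ , _ , inj₂ (inj₂ (inj₂ refl)) , refl = ⊥-elim (q∉ (westEnd∈tails (κ-east (n , n≤ , refl))))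
  ... | n , n≤ , _ , inj₂ (inj₁ refl) , refl rewrite κb≡b n≤ with b-cases n n≤
  ...   | inj₁ b∈   = b∈
  ...   | inj₂ west = ⊥-elim (q∉ (westEnd∈tails west))

  sink⇒vertex∉tails : ∀ {q} → q ∈ sinks → q ∈ vertices ds × q ∉ tails
  sink⇒vertex∉tails q∈ with ∈-sinks⁻ q∈
  ... | n , n≤ , refl , ¬west =
    subst (_∈ vertices ds) (κb≡b n≤) (∈-vertices⁺ n≤ (cornerB∈corners (isOdd n) (P n) (suc n))) ,
    λ b∈ → [ not-¬ (b-odd n≤) , ¬west ] (tails-even-or-west b∈)

  ∈-sources : ∀ {q} → (q ∈ vertices ds × q ∉ heads) ⇔ q ∈ sources
  ∈-sources = mk⇔ (λ (q∈ , q∉) → vertex∉heads⇒source q∈ q∉) source⇒vertex∉heads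

  ∈-sinks : ∀ {q} → (q ∈ vertices ds × q ∉ tails) ⇔ q ∈ sinks
  ∈-sinks = mk⇔ (λ (q∈ , q∉) → vertex∉tails⇒sink q∈ q∉) sink⇒vertex∉tails

  -- Their decision bits are isSource and isSink themselves, so that numSources and numSinks
  -- are lengths of filters by these.
  source? : Decidable (_∉ heads)
  source? q = isSource ds q because ¬-reflects (anyᵇ-==P-reflects proj₂ q (arrows ds))

  sink? : Decidable (_∉ tails)
  sink? q = isSink ds q because ¬-reflects (anyᵇ-==P-reflects proj₁ q (arrows ds))

  length-hourglasses : length hourglasses ≡ numHourglasses ds
  length-hourglasses = length-hourglassesFrom 0 ds

  length-sources : length sources ≡ suc (numHourglasses ds)
  length-sources = cong suc (trans (length-map (a ∘ suc) hourglasses) length-hourglasses)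

  length-sinks : length sinks ≡ suc (numHourglasses ds)
  length-sinks = cong suc (trans (length-map b hourglasses) length-hourglasses)

  open ≡-Reasoning

  numSources≡ : numSources ds ≡ suc (numHourglasses ds)
  numSources≡ = begin
    numSources ds                         ≡⟨ cong length (filterᵇ≡filter source? (λ _ → refl) (vertices ds)) ⟩
    length (filter source? (vertices ds)) ≡⟨ length-filter-unique source? vertices-unique sources-unique ∈-sources ⟩
    length sources                        ≡⟨ length-sources ⟩
    suc (numHourglasses ds)               ∎

  numSinks≡ : numSinks ds ≡ suc (numHourglasses ds)
  numSinks≡ = begin
    numSinks ds                         ≡⟨ cong length (filterᵇ≡filter sink? (λ _ → refl) (vertices ds)) ⟩
    length (filter sink? (vertices ds)) ≡⟨ length-filter-unique sink? vertices-unique sinks-unique ∈-sinks ⟩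
    length sinks                        ≡⟨ length-sinks ⟩
    suc (numHourglasses ds)             ∎

≡suc⇒≡⇔suc≡ : ∀ {h n k} → n ≡ suc h → (h ≡ k ⇔ n ≡ suc k)
≡suc⇒≡⇔suc≡ n≡ = mk⇔ (λ h≡k → trans n≡ (cong suc h≡k)) (λ n≡sk → suc-injective (trans (sym n≡) n≡sk))

corollary3p11 : (G : SnakeGraph) (k : ℕ) → 1 ≤ k →
    ((numHourglasses G ≡ k ∸ 1) ⇔ (numSources G ≡ k))
      × ((numHourglasses G ≡ k ∸ 1) ⇔ (numSinks G ≡ k))
corollary3p11 G (suc k) _ = ≡suc⇒≡⇔suc≡ numSources≡ , ≡suc⇒≡⇔suc≡ numSinks≡
  where open Snake G
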